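{- Let $C_n=((v_0,\dots,v_{n-1}),c)$ be an edge-colored oriented cycle of order $n$. Suppose there exists $i\in[n]$ such that for every $s\in[n]$ either $c(e_{s-1})=c(e_{i-s-1})$ and $c(e_s)=c(e_{i-s})$, or $c(e_{s-1})=\overline{c(e_{i-s})}$ and $c(e_s)=\overline{c(e_{i-s-1})}$. If there exist no directed colors $c_0,c_1$ such that $c(e_{2k})=c_0$ and $c(e_{2k+1})=c_1$ for every $k\in[n]$, then $\varphi(v_x)=v_{i-x}$ defines a color respecting automorphism of $C_n$.
   Context: All indices are modulo $n$. For distinct vertices $v_0,\dots,v_{n-1}$, let $e_i=\{v_i,v_{i+1}\}$ and $E=\{e_i:i\in[n]\}$. Given a set $A$ of colors and a map $c:E\to\mathbb F_3\times A$, the pair $C_n=((v_0,\dots,v_{n-1}),c)$ is an edge-colored oriented cycle; $c(e)$ is the directed color of $e$, $c(e)_1\in\mathbb F_3$ its orientation, $c(e)_2$ its undirected color, and $\overline{c(e)}=(-c(e)_1,c(e)_2)$. A bijection $\varphi$ of $\{v_0,\dots,v_{n-1}\}$ is a color respecting automorphism if for every $i\in[n]$ there is $j\in[n]$ with $\{\varphi(v_i),\varphi(v_{i+1})\}=\{v_j,v_{j+1}\}$ and $c(\{\varphi(v_i),\varphi(v_{i+1})\})$ equals $c(\{v_j,v_{j+1}\})$ if $(\varphi(v_i),\varphi(v_{i+1}))=(v_j,v_{j+1})$ and equals $\overline{c(\{v_j,v_{j+1}\})}$ if $(\varphi(v_i),\varphi(v_{i+1}))=(v_{j+1},v_j)$.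 -}

module Defs where

open import Data.Nat using (ℕ; NonZero)
open import Data.Nat.DivMod using (_mod_)
open import Data.Integer using (ℤ; +_; _+_; _-_; _%ℕ_)
open import Data.Fin using (Fin; toℕ; zero; suc)
open import Data.Product using (_×_; _,_; ∃-syntax)
open import Data.Sum using (_⊎_)
open import Relation.Binary.PropositionalEquality using (_≡_)
open import Function.Definitions using (Bijective)

𝔽₃ : Set
𝔽₃ = Fin 3

neg₃ : 𝔽₃ → 𝔽₃
neg₃ zero = zero
neg₃ (suc zero) = suc (suc zero)
neg₃ (suc (suc zero)) = suc zero

DColor : Set → Set
DColor A = 𝔽₃ × A

-- overline: reverse the orientation
bar : {A : Set} → DColor A → DColor A
bar (o , a) = (neg₃ o , a)

ι : (n : ℕ) .{{_ : NonZero n}} → ℤ → Fin n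
ι n k = (k %ℕ n) mod n

-- An edge-colored oriented cycle of order n: vertices v_0..v_{n-1} are
-- identified with Fin n (v_x ↦ x), and the coloring is given on edge
-- indices: col j = c(e_j) with e_j = {v_j , v_{j+1}}.
IsColorRespectingAut : {A : Set} (n : ℕ) .{{_ : NonZero n}} →
  (Fin n → DColor A) → (Fin n → Fin n) → Set
IsColorRespectingAut n col φ =
  Bijective _≡_ _≡_ φ ×
  ((i : Fin n) → ∃[ j ]
     ( (φ i ≡ j × φ (ι n (+ toℕ i + + 1)) ≡ ι n (+ toℕ j + + 1)
         × col i ≡ col j)
     ⊎ (φ i ≡ ι n (+ toℕ j + + 1) × φ (ι n (+ toℕ i + + 1)) ≡ j
         × col i ≡ bar (col j))))

-- Say the reflection x ↦ i - x flips the edge e_z when it maps e_z onto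
-- e_{i-z-1} with the barred color. If the hypothesis holds at some s in its
-- barred form, the reflection flips e_s; the hypothesis at z+1, in either
-- form, carries a flip of e_z over to e_{z+1}, so every edge is flipped and
-- the reflection respects colors. Otherwise the unbarred form holds at every
-- s, and using it at s and at i - s gives c(e_z) = c(e_{z+2}) for all z: the
-- coloring alternates between two directed colors, which is excluded.
module Submission where

open import Defs
open import Data.Nat using (ℕ; NonZero; _≤_)
open import Data.Integer using (ℤ; +_; _+_; _-_; _*_)
open import Data.Fin using (Fin; toℕ)
open import Data.Product using (_×_; ∃-syntax)
open import Data.Sum using (_⊎_)
open import Relation.Nullary using (¬_)
open import Relation.Binary.PropositionalEquality using (_≡_)

import Data.Nat as ℕ
open import Data.Nat.DivMod using (_%_; _mod_; m<n⇒m%n≡m; [m+kn]%n≡m%n; m%n<n)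
open import Data.Integer using (-[1+_]; -_; _%ℕ_; _/ℕ_)
open import Data.Integer.Properties using (+-injective; pos-+; pos-*)
open import Data.Integer.DivMod using (a≡a%ℕn+[a/ℕn]*n; n%ℕd<d)
open import Data.Integer.Tactic.RingSolver using (solve-∀)
open import Data.Fin using (zero; suc)
open import Data.Fin.Properties using (toℕ-fromℕ<; toℕ-injective; toℕ<n)
open import Data.Product using (_,_; proj₁; proj₂)
open import Data.Sum using (inj₁; inj₂; [_,_]′)
import Data.Sum as Sum
open import Data.Empty using (⊥-elim)
open import Function.Definitions using (Bijective)
open import Function.Consequences.Propositional
  using (inverseᵇ⇒bijective; strictlyInverseˡ⇒inverseˡ; strictlyInverseʳ⇒inverseʳ)
open import Relation.Binary.PropositionalEquality
  using (refl; sym; trans; cong; subst; module ≡-Reasoning)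

open ≡-Reasoning

involutive⇒bijective : ∀ {a} {X : Set a} {f : X → X} →
  (∀ x → f (f x) ≡ x) → Bijective _≡_ _≡_ f
involutive⇒bijective {f = f} ff≡id = inverseᵇ⇒bijective
  ( strictlyInverseˡ⇒inverseˡ f ff≡id
  , strictlyInverseʳ⇒inverseʳ f ff≡id )

all⊎any : ∀ m {p q} {P : Fin m → Set p} {Q : Fin m → Set q} →
  (∀ s → P s ⊎ Q s) → (∀ s → P s) ⊎ ∃[ s ] Q s
all⊎any ℕ.zero    P⊎Q = inj₁ λ ()
all⊎any (ℕ.suc m) P⊎Q with P⊎Q zero | all⊎any m (λ s → P⊎Q (suc s))
... | inj₂ q₀ | _              = inj₂ (zero , q₀)
... | inj₁ _  | inj₂ (s , qₛ)  = inj₂ (suc s , qₛ)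
... | inj₁ p₀ | inj₁ pₛ        = inj₁ λ { zero → p₀ ; (suc s) → pₛ s }

2-periodic⇒alternating : ∀ {a} {X : Set a} (f : ℤ → X) →
  (∀ z → f (z + + 2) ≡ f z) →
  ∀ m → f (+ 2 * + m) ≡ f (+ 0) × f (+ 2 * + m + + 1) ≡ f (+ 1)
2-periodic⇒alternating f f-periodic ℕ.zero = refl , refl
2-periodic⇒alternating f f-periodic (ℕ.suc m)
  with even , odd ← 2-periodic⇒alternating f f-periodic m =
    trans (cong f (double-suc (+ m))) (trans (f-periodic _) even)
  , trans (cong f (double-suc-+1 (+ m))) (trans (f-periodic _) odd)
  where
  double-suc : ∀ m → + 2 * (+ 1 + m) ≡ + 2 * m + + 2
  double-suc = solve-∀
  double-suc-+1 : ∀ m → + 2 * (+ 1 + m) + + 1 ≡ + 2 * m + + 1 + + 2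
  double-suc-+1 = solve-∀

bar-involutive : {A : Set} (c : DColor A) → bar (bar c) ≡ c
bar-involutive (zero , a)             = refl
bar-involutive (suc zero , a)         = refl
bar-involutive (suc (suc zero) , a)   = refl

%-unique : ∀ {r r' n} .{{_ : NonZero n}} m →
  r ℕ.< n → r' ℕ.< n → r ≡ r' ℕ.+ m ℕ.* n → r ≡ r'
%-unique {r} {r'} {n} m r<n r'<n r≡r'+mn = begin
  r                    ≡⟨ m<n⇒m%n≡m r<n ⟨
  r % n                ≡⟨ cong (_% n) r≡r'+mn ⟩
  (r' ℕ.+ m ℕ.* n) % n ≡⟨ [m+kn]%n≡m%n r' m n ⟩
  r' % n               ≡⟨ m<n⇒m%n≡m r'<n ⟩
  r'                   ∎

module Residues (n : ℕ) .{{_ : NonZero n}} where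

  %ℕ-unique : ∀ {r r'} → r ℕ.< n → r' ℕ.< n →
    ∀ d → + r ≡ + r' + d * + n → r ≡ r'
  %ℕ-unique {r} {r'} r<n r'<n (+ m) e = %-unique m r<n r'<n (+-injective (begin
    + r                   ≡⟨ e ⟩
    + r' + + m * + n      ≡⟨ cong (λ t → + r' + t) (pos-* m n) ⟨
    + r' + + (m ℕ.* n)    ≡⟨ pos-+ r' (m ℕ.* n) ⟨
    + (r' ℕ.+ m ℕ.* n)    ∎))
  %ℕ-unique {r} {r'} r<n r'<n -[1+ m ] e =
    sym (%-unique (ℕ.suc m) r'<n r<n (+-injective (begin
      + r'                          ≡⟨ cancel (+ r') -[1+ m ] (+ n) ⟩
      + r' + -[1+ m ] * + n + + ℕ.suc m * + n
                                    ≡⟨ cong (_+ + ℕ.suc m * + n) e ⟨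
      + r + + ℕ.suc m * + n         ≡⟨ cong (λ t → + r + t) (pos-* (ℕ.suc m) n) ⟨
      + r + + (ℕ.suc m ℕ.* n)       ≡⟨ pos-+ r (ℕ.suc m ℕ.* n) ⟨
      + (r ℕ.+ ℕ.suc m ℕ.* n)       ∎)))
    where
    cancel : ∀ a d N → a ≡ a + d * N + (- d) * N
    cancel = solve-∀

  %ℕ-+-* : ∀ a k → (a + k * + n) %ℕ n ≡ a %ℕ n
  %ℕ-+-* a k = %ℕ-unique (n%ℕd<d b n) (n%ℕd<d a n) (a /ℕ n + k - b /ℕ n) (begin
    + (b %ℕ n)                                     ≡⟨ isolate (+ (b %ℕ n)) (b /ℕ n) (+ n) ⟩
    + (b %ℕ n) + b /ℕ n * + n - b /ℕ n * + n       ≡⟨ cong (_- b /ℕ n * + n) (a≡a%ℕn+[a/ℕn]*n b n) ⟨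
    a + k * + n - b /ℕ n * + n                     ≡⟨ cong (λ t → t + k * + n - b /ℕ n * + n) (a≡a%ℕn+[a/ℕn]*n a n) ⟩
    + (a %ℕ n) + a /ℕ n * + n + k * + n - b /ℕ n * + n
                                                   ≡⟨ collect (+ (a %ℕ n)) (a /ℕ n) k (b /ℕ n) (+ n) ⟩
    + (a %ℕ n) + (a /ℕ n + k - b /ℕ n) * + n       ∎)
    where
    b = a + k * + n
    isolate : ∀ r q N → r ≡ r + q * N - q * N
    isolate = solve-∀
    collect : ∀ r q k q' N → r + q * N + k * N - q' * N ≡ r + (q + k - q') * N
    collect = solve-∀

  infix 4 _≈_
  data _≈_ (a b : ℤ) : Set where
    ≈-by : ∀ k → a ≡ b + k * + n → a ≈ b

  ≈⇒ι≡ : ∀ {a b} → a ≈ b → ι n a ≡ ι n b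
  ≈⇒ι≡ {b = b} (≈-by k refl) = cong (_mod n) (%ℕ-+-* b k)

  toℕ-ι : ∀ a → toℕ (ι n a) ≡ a %ℕ n
  toℕ-ι a = trans (toℕ-fromℕ< (m%n<n (a %ℕ n) n)) (m<n⇒m%n≡m (n%ℕd<d a n))

  ι-toℕ : (x : Fin n) → ι n (+ toℕ x) ≡ x
  ι-toℕ x = toℕ-injective (trans (toℕ-ι (+ toℕ x)) (m<n⇒m%n≡m (toℕ<n x)))

  toℕ-ι-≈ : ∀ a → + toℕ (ι n a) ≈ a
  toℕ-ι-≈ a = ≈-by (- (a /ℕ n)) (begin
    + toℕ (ι n a)                        ≡⟨ cong +_ (toℕ-ι a) ⟩
    + (a %ℕ n)                           ≡⟨ isolate (+ (a %ℕ n)) (a /ℕ n) (+ n) ⟩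
    + (a %ℕ n) + a /ℕ n * + n + (- (a /ℕ n)) * + n
                                         ≡⟨ cong (_+ (- (a /ℕ n)) * + n) (a≡a%ℕn+[a/ℕn]*n a n) ⟨
    a + (- (a /ℕ n)) * + n               ∎)
    where
    isolate : ∀ r q N → r ≡ r + q * N + (- q) * N
    isolate = solve-∀

  ≈-+ʳ : ∀ {a b} w → a ≈ b → a + w ≈ b + w
  ≈-+ʳ {b = b} w (≈-by k refl) = ≈-by k (swap b k w (+ n))
    where
    swap : ∀ b k w N → b + k * N + w ≡ b + w + k * N
    swap = solve-∀

  +-residue-diff-≈ : ∀ a b → a + + toℕ (ι n (b - a)) ≈ b
  +-residue-diff-≈ a b with ≈-by k r≡b-a+kn ← toℕ-ι-≈ (b - a) = ≈-by k (begin
    a + + toℕ (ι n (b - a))   ≡⟨ cong (λ t → a + t) r≡b-a+kn ⟩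
    a + (b - a + k * + n)     ≡⟨ cancel a b k (+ n) ⟩
    b + k * + n               ∎)
    where
    cancel : ∀ a b k N → a + (b - a + k * N) ≡ b + k * N
    cancel = solve-∀

  ≈-reflect : ∀ {a b} w → a ≈ b → w - a ≈ w - b
  ≈-reflect {b = b} w (≈-by k refl) = ≈-by (- k) (distrib b k w (+ n))
    where
    distrib : ∀ b k w N → w - (b + k * N) ≡ w - b + (- k) * N
    distrib = solve-∀

  ∀Fin⇒∀ℤ : ∀ {p} {P : ℤ → Set p} → (∀ {a b} → a ≈ b → P a → P b) →
    ((s : Fin n) → P (+ toℕ s)) → ∀ z → P z
  ∀Fin⇒∀ℤ P-resp P-Fin z = P-resp (toℕ-ι-≈ z) (P-Fin (ι n z))

module Reflection {A : Set} (n : ℕ) .{{_ : NonZero n}}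
                  (col : Fin n → DColor A) (i : Fin n) where
  open Residues n

  C : ℤ → DColor A
  C z = col (ι n z)

  I : ℤ
  I = + toℕ i

  ColorsAgree ColorsReverse FlipsEdge : ℤ → Set
  ColorsAgree z   = C (z - + 1) ≡ C (I - z - + 1) × C z ≡ C (I - z)
  ColorsReverse z = C (z - + 1) ≡ bar (C (I - z)) × C z ≡ bar (C (I - z - + 1))
  -- x ↦ i - x maps the edge e_z onto e_{i-z-1}, reversing its orientation.
  FlipsEdge z     = C z ≡ bar (C (I - z - + 1))

  module _ {a b : ℤ} (a≈b : a ≈ b) where
    C-cong : C a ≡ C b
    C-cong = cong col (≈⇒ι≡ a≈b)

    C-cong-pred : C (a - + 1) ≡ C (b - + 1)
    C-cong-pred = cong col (≈⇒ι≡ (≈-+ʳ (- + 1) a≈b))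

    C-cong-reflect : C (I - a) ≡ C (I - b)
    C-cong-reflect = cong col (≈⇒ι≡ (≈-reflect I a≈b))

    C-cong-reflect-pred : C (I - a - + 1) ≡ C (I - b - + 1)
    C-cong-reflect-pred = cong col (≈⇒ι≡ (≈-+ʳ (- + 1) (≈-reflect I a≈b)))

    ColorsAgree-resp : ColorsAgree a → ColorsAgree b
    ColorsAgree-resp (pred , here) =
        trans (sym C-cong-pred) (trans pred C-cong-reflect-pred)
      , trans (sym C-cong) (trans here C-cong-reflect)

    ColorsReverse-resp : ColorsReverse a → ColorsReverse b
    ColorsReverse-resp (pred , here) =
        trans (sym C-cong-pred) (trans pred (cong bar C-cong-reflect))
      , trans (sym C-cong) (trans here (cong bar C-cong-reflect-pred))

    FlipsEdge-resp : FlipsEdge a → FlipsEdge b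
    FlipsEdge-resp flip = trans (sym C-cong) (trans flip (cong bar C-cong-reflect-pred))

  -- In the first case the flip of e_z carries over to e_{z+1}, since the
  -- hypothesis at z+1 relates e_z to e_{i-z-1} and e_{z+1} to e_{i-z}.
  FlipsEdge-suc : ∀ z → ColorsAgree (z + + 1) ⊎ ColorsReverse (z + + 1) →
    FlipsEdge z → FlipsEdge (z + + 1)
  FlipsEdge-suc z (inj₂ (_ , flip)) _    = flip
  FlipsEdge-suc z (inj₁ (pred , here)) flip = begin
    C (z + + 1)                     ≡⟨ here ⟩
    C (I - (z + + 1))               ≡⟨ cong C (reflect-suc I z) ⟩
    C (I - z - + 1)                 ≡⟨ bar-involutive _ ⟨
    bar (bar (C (I - z - + 1)))     ≡⟨ cong bar flip ⟨
    bar (C z)                       ≡⟨ cong (λ t → bar (C t)) (suc-pred z) ⟨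
    bar (C (z + + 1 - + 1))         ≡⟨ cong bar pred ⟩
    bar (C (I - (z + + 1) - + 1))   ∎
    where
    reflect-suc : ∀ I z → I - (z + + 1) ≡ I - z - + 1
    reflect-suc = solve-∀
    suc-pred : ∀ z → z + + 1 - + 1 ≡ z
    suc-pred = solve-∀

  module _ (cases : ∀ z → ColorsAgree z ⊎ ColorsReverse z) where

    FlipsEdge-+ : ∀ z k → FlipsEdge z → FlipsEdge (z + + k)
    FlipsEdge-+ z ℕ.zero    flip = subst FlipsEdge (+-zero z) flip
      where
      +-zero : ∀ z → z ≡ z + + 0
      +-zero = solve-∀
    FlipsEdge-+ z (ℕ.suc k) flip =
      subst FlipsEdge (+-suc z (+ k))
        (FlipsEdge-suc (z + + k) (cases (z + + k + + 1)) (FlipsEdge-+ z k flip))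
      where
      +-suc : ∀ z k → z + k + + 1 ≡ z + (+ 1 + k)
      +-suc = solve-∀

    FlipsEdge-everywhere : ∀ z₀ → FlipsEdge z₀ → ∀ z → FlipsEdge z
    FlipsEdge-everywhere z₀ flip z =
      FlipsEdge-resp (+-residue-diff-≈ z₀ z) (FlipsEdge-+ z₀ _ flip)

  ColorsAgree⇒2-periodic : (∀ z → ColorsAgree z) → ∀ z → C (z + + 2) ≡ C z
  ColorsAgree⇒2-periodic agree z = begin
    C (z + + 2)                     ≡⟨ cong C (double-reflect I z) ⟨
    C (I - (I - (z + + 1) - + 1))   ≡⟨ proj₂ (agree (I - (z + + 1) - + 1)) ⟨
    C (I - (z + + 1) - + 1)         ≡⟨ proj₁ (agree (z + + 1)) ⟨
    C (z + + 1 - + 1)               ≡⟨ cong C (suc-pred z) ⟩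
    C z                             ∎
    where
    double-reflect : ∀ I z → I - (I - (z + + 1) - + 1) ≡ z + + 2
    double-reflect = solve-∀
    suc-pred : ∀ z → z + + 1 - + 1 ≡ z
    suc-pred = solve-∀

  FlipsEdge-everywhere⊎alternating :
    ((s : Fin n) → ColorsAgree (+ toℕ s) ⊎ ColorsReverse (+ toℕ s)) →
    (∀ z → FlipsEdge z) ⊎ (∀ m → C (+ 2 * + m) ≡ C (+ 0) × C (+ 2 * + m + + 1) ≡ C (+ 1))
  FlipsEdge-everywhere⊎alternating cases with all⊎any n cases
  ... | inj₂ (s , _ , flip) = inj₁ (FlipsEdge-everywhere cases-ℤ (+ toℕ s) flip)
    where
    cases-ℤ : ∀ z → ColorsAgree z ⊎ ColorsReverse z
    cases-ℤ = ∀Fin⇒∀ℤ (λ a≈b → Sum.map (ColorsAgree-resp a≈b) (ColorsReverse-resp a≈b)) cases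
  ... | inj₁ agree = inj₂ (2-periodic⇒alternating C
          (ColorsAgree⇒2-periodic (∀Fin⇒∀ℤ ColorsAgree-resp agree)))

  reflection : Fin n → Fin n
  reflection x = ι n (I - + toℕ x)

  reflection-involutive : ∀ x → reflection (reflection x) ≡ x
  reflection-involutive x = begin
    ι n (I - + toℕ (ι n (I - + toℕ x)))   ≡⟨ ≈⇒ι≡ (≈-reflect I (toℕ-ι-≈ (I - + toℕ x))) ⟩
    ι n (I - (I - + toℕ x))               ≡⟨ cong (ι n) (double-reflect I (+ toℕ x)) ⟩
    ι n (+ toℕ x)                         ≡⟨ ι-toℕ x ⟩
    x                                     ∎
    where
    double-reflect : ∀ I x → I - (I - x) ≡ x
    double-reflect = solve-∀

  FlipsEdge⇒automorphism : (∀ z → FlipsEdge z) →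
    IsColorRespectingAut n col reflection
  FlipsEdge⇒automorphism flip =
    involutive⇒bijective reflection-involutive , λ x → ι n (I - + toℕ x - + 1) , inj₂ (edge x)
    where
    edge : ∀ x → let j = ι n (I - + toℕ x - + 1) in
      reflection x ≡ ι n (+ toℕ j + + 1) × reflection (ι n (+ toℕ x + + 1)) ≡ j
        × col x ≡ bar (col j)
    edge x =
        sym (trans (≈⇒ι≡ (≈-+ʳ (+ 1) (toℕ-ι-≈ (I - X - + 1)))) (cong (ι n) (pred-suc (I - X))))
      , trans (≈⇒ι≡ (≈-reflect I (toℕ-ι-≈ (X + + 1)))) (cong (ι n) (reflect-suc I X))
      , trans (cong col (sym (ι-toℕ x))) (flip X)
      where
      X = + toℕ x
      pred-suc : ∀ z → z - + 1 + + 1 ≡ z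
      pred-suc = solve-∀
      reflect-suc : ∀ I z → I - (z + + 1) ≡ I - z - + 1
      reflect-suc = solve-∀

proposition4p6 : {A : Set} (n : ℕ) {{_ : NonZero n}} → 3 ≤ n →
    (col : Fin n → DColor A) →
    (i : Fin n) →
    ((s : Fin n) →
        (col (ι n (+ toℕ s - + 1)) ≡ col (ι n (+ toℕ i - + toℕ s - + 1))
          × col (ι n (+ toℕ s)) ≡ col (ι n (+ toℕ i - + toℕ s)))
        ⊎ (col (ι n (+ toℕ s - + 1)) ≡ bar (col (ι n (+ toℕ i - + toℕ s)))
          × col (ι n (+ toℕ s)) ≡ bar (col (ι n (+ toℕ i - + toℕ s - + 1))))) →
    ¬ (∃[ c₀ ] ∃[ c₁ ] ((k : Fin n) →
        col (ι n (+ 2 * + toℕ k)) ≡ c₀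
          × col (ι n (+ 2 * + toℕ k + + 1)) ≡ c₁)) →
    IsColorRespectingAut n col (λ x → ι n (+ toℕ i - + toℕ x))
proposition4p6 n _ col i cases not-alternating =
  [ FlipsEdge⇒automorphism
  , (λ alternating → ⊥-elim (not-alternating (_ , _ , λ k → alternating (toℕ k))))
  ]′ (FlipsEdge-everywhere⊎alternating cases)
  where
  open Reflection n col i
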